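{- Let $q=2^m$, let $h$ be a positive integer with $\gcd(h,m)=1$, and let $f(x)=x^{2^h}$. Then $\mathbf{D}(f,q/2)=(\mathrm{GF}(q),\mathcal{B}_{(f,q/2)})$ is a $3$-$\left(q,\ q/2,\ (q-4)/4\right)$ design.
   Context: For a polynomial $f$ over $\mathrm{GF}(q)$ (viewed as a function $\mathrm{GF}(q)\to\mathrm{GF}(q)$), for $(b,c)\in\mathrm{GF}(q)^2$ put $B_{(f,b,c)}=\{f(x)+bx+c: x\in \mathrm{GF}(q)\}$. For an integer $k$ with $2\le k\le q$, $\mathcal{B}_{(f,k)}=\{B_{(f,b,c)}: |B_{(f,b,c)}|=k,\ b,c\in\mathrm{GF}(q)\}$ (a set, so each block appears once), and $\mathbf{D}(f,k)$ is the incidence structure with point set $\mathrm{GF}(q)$, block set $\mathcal{B}_{(f,k)}$ and incidence given by membership. A $t$-$(v,k,\lambda)$ design is a pair $(\mathcal{P},\mathcal{B})$ with $|\mathcal{P}|=v$ and $\mathcal{B}$ a set of $k$-subsets of $\mathcal{P}$ such that every $t$-subset of $\mathcal{P}$ is contained in exactly $\lambda$ members of $\mathcal{B}$. -}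

module Defs where

open import Level using (0ℓ)
open import Data.Nat as ℕ using (ℕ; zero; suc)
open import Data.Fin using (Fin)
open import Data.Fin.Properties using (_≟_)
open import Data.Fin.Subset using (Subset; _∈_; ∣_∣)
open import Data.Bool using (Bool; true; false)
open import Data.Vec using (tabulate)
open import Data.Product using (Σ; ∃; ∃-syntax; _×_; _,_)
open import Data.List using (List; length)
open import Data.List.Relation.Unary.Unique.Propositional using (Unique)
import Data.List.Membership.Propositional as LM
open import Relation.Nullary using (¬_; does)
open import Relation.Nullary.Decidable using (⌊_⌋)
open import Relation.Binary.PropositionalEquality using (_≡_; _≢_)
open import Algebra.Core using (Op₁; Op₂)
open import Algebra.Structures using (IsCommutativeRing)
open import Data.Fin.Properties using (any?)

-- A finite field whose elements are Fin q, with propositional equality.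
-- (GF(q) is unique up to isomorphism, so any such field is "the" GF(q).)
record FiniteField (q : ℕ) : Set where
  field
    _+_ _*_ : Op₂ (Fin q)
    -_      : Op₁ (Fin q)
    0# 1#   : Fin q
    isCommutativeRing : IsCommutativeRing _≡_ _+_ _*_ -_ 0# 1#
    0≢1     : 0# ≢ 1#
    inverse : ∀ x → x ≢ 0# → ∃[ y ] (x * y ≡ 1#)

  infixl 7 _*_
  infixl 6 _+_

  _^_ : Fin q → ℕ → Fin q
  x ^ zero  = 1#
  x ^ suc n = x * (x ^ n)

_⇔'_ : Set → Set → Set
A ⇔' B = (A → B) × (B → A)
infix 3 _⇔'_

module _ {q : ℕ} (F : FiniteField q) where
  open FiniteField F

  block : (Fin q → Fin q) → Fin q → Fin q → Subset q
  block f b c = tabulate λ y → ⌊ any? (λ x → f x + b * x + c ≟ y) ⌋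

  IsBlock : (Fin q → Fin q) → ℕ → Subset q → Set
  IsBlock f k S = ∃[ b ] ∃[ c ] (S ≡ block f b c) × ∣ S ∣ ≡ k

  -- D(f,k) is a 3-(q,k,λ) design: the point set GF(q) has q points and
  -- every block has size k by construction; for every 3-subset {x,y,z}
  -- of distinct points, the blocks of 𝓑_(f,k) (a set: counted without
  -- repetition) containing it are exactly the entries of a duplicate-free
  -- list of length lam.
  Is3Design : (Fin q → Fin q) → ℕ → ℕ → Set
  Is3Design f k lam =
    ∀ (x y z : Fin q) → x ≢ y → x ≢ z → y ≢ z →
    ∃[ Bs ] (Unique Bs × length Bs ≡ lam ×
      (∀ S → S LM.∈ Bs ⇔' (IsBlock f k S × x ∈ S × y ∈ S × z ∈ S)))

module Submission where

-- By Fermat's little theorem GF(q) has characteristic 2, so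
-- L(s) = s^(2^h) + s is additive; as gcd(h, m) = 1 its kernel is {0, 1}, and
-- its image T is a hyperplane: an additive subgroup of index 2 with |T| = q/2
-- whose only multiplier cT = T is c = 1.  Substituting x = s w shows that the
-- block with slope b = w^(2^h - 1) ≠ 0 and constant c is the affine hyperplane
-- {y | (y + c) w^(-2^h) ∈ T}, while slope 0 gives the whole field.  So the
-- blocks of size q/2 through a point x₀ are exactly the sets
-- {y | (y + x₀) a ∈ T}, a ≠ 0, each determined by a.  Those through distinct
-- x₀, y₀, z₀ correspond to the a ≠ 0 with a u, a v ∈ T (u = x₀ + y₀,
-- v = x₀ + z₀), and a double count using that T has index 2 yields q/4 - 1.

open import Defs
open import Data.Nat using (ℕ; _≤_; _^_; _∸_; _/_; NonZero)
open import Data.Nat.GCD using (gcd)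
open import Relation.Binary.PropositionalEquality using (_≡_)

open import Level using (0ℓ)
open import Data.Nat as ℕ using (zero; suc)
import Data.Nat.Properties as ℕₚ
open import Data.Nat.DivMod using (m*n/n≡m)
open import Data.Nat.GCD using (GCD; gcd-GCD; module Bézout)
import Data.Nat.Tactic.RingSolver as ℕSolver
open import Data.Fin using (Fin; zero; suc; punchIn; punchOut; _<_)
import Data.Fin.Properties as Finₚ
open import Data.Fin.Permutation using (Permutation; permutation)
open import Data.Fin.Subset using (Subset; _∈_; ∣_∣)
import Data.Vec as Vec
import Data.Vec.Properties as Vecₚ
open import Data.Bool using (true; if_then_else_)
open import Data.Maybe using (nothing)
open import Data.List using (List; length; map; filter; allFin; tabulate)
open import Data.List.Properties using (length-map)
import Data.List.Membership.Propositional as Membership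
open import Data.List.Membership.Propositional.Properties using (∈-map⁺; ∈-map⁻; ∈-filter⁺; ∈-filter⁻; ∈-allFin)
open import Data.List.Relation.Unary.Unique.Propositional using (Unique)
import Data.List.Relation.Unary.Unique.Propositional.Properties as Unique
open import Data.Product using (∃; ∃-syntax; _×_; _,_; proj₁; proj₂)
open import Data.Sum using (_⊎_; inj₁; inj₂)
open import Data.Empty using (⊥-elim)
open import Relation.Nullary using (¬_; Dec; yes; no; ¬?; _×-dec_)
open import Relation.Nullary.Decidable using (⌊_⌋)
open import Relation.Unary using (Pred; Decidable)
open import Relation.Binary.Definitions using (tri<; tri≈; tri>)
open import Relation.Binary.PropositionalEquality
open import Algebra.Bundles using (CommutativeRing)
open import Algebra.Structures using (IsCommutativeRing)
import Algebra.Properties.CommutativeMonoid.Sum as MonoidSum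
import Algebra.Properties.Ring
open import Tactic.RingSolver.Core.AlmostCommutativeRing using (AlmostCommutativeRing; fromCommutativeRing)
open import Tactic.RingSolver using (solve-∀)

open MonoidSum ℕₚ.+-0-commutativeMonoid using (sum; sum-cong-≗; sum-permute; ∑-distrib-+)

⌊⌋-cong : ∀ {A B : Set} (a : Dec A) (b : Dec B) → A ⇔' B → ⌊ a ⌋ ≡ ⌊ b ⌋
⌊⌋-cong (yes _) (yes _) _       = refl
⌊⌋-cong (yes a) (no ¬b) (f , _) = ⊥-elim (¬b (f a))
⌊⌋-cong (no ¬a) (yes b) (_ , g) = ⊥-elim (¬a (g b))
⌊⌋-cong (no _)  (no _)  _       = refl

⌊⌋-sound : ∀ {A : Set} (d : Dec A) → ⌊ d ⌋ ≡ true → A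
⌊⌋-sound (yes a) _ = a

⌊⌋-complete : ∀ {A : Set} (d : Dec A) → A → ⌊ d ⌋ ≡ true
⌊⌋-complete (yes _) _ = refl
⌊⌋-complete (no ¬a) a = ⊥-elim (¬a a)

indicator : ∀ {A : Set} → Dec A → ℕ
indicator d = if ⌊ d ⌋ then 1 else 0

indicator-cong : ∀ {A B : Set} (a : Dec A) (b : Dec B) → A ⇔' B → indicator a ≡ indicator b
indicator-cong a b A⇔B = cong (λ x → if x then 1 else 0) (⌊⌋-cong a b A⇔B)

count : ∀ {n} {P : Pred (Fin n) 0ℓ} → Decidable P → ℕ
count P? = sum (λ i → indicator (P? i))

sum-1 : ∀ n → sum {n} (λ _ → 1) ≡ n
sum-1 zero    = refl
sum-1 (suc n) = cong suc (sum-1 n)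

count-cong : ∀ {n} {P Q : Pred (Fin n) 0ℓ} (P? : Decidable P) (Q? : Decidable Q) →
             (∀ i → P i ⇔' Q i) → count P? ≡ count Q?
count-cong P? Q? P⇔Q = sum-cong-≗ (λ i → indicator-cong (P? i) (Q? i) (P⇔Q i))

count-bijection : ∀ {n} {P : Pred (Fin n) 0ℓ} (P? : Decidable P) (f g : Fin n → Fin n) →
                  (∀ y → f (g y) ≡ y) → (∀ x → g (f x) ≡ x) → count (λ i → P? (f i)) ≡ count P?
count-bijection P? f g fg gf = sym (sum-permute (λ i → indicator (P? i)) (permutation f g fg gf))

count-complement : ∀ {n} {P : Pred (Fin n) 0ℓ} (P? : Decidable P) →
                   count P? ℕ.+ count (λ i → ¬? (P? i)) ≡ n
count-complement {zero}  P? = refl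
count-complement {suc n} P? with P? zero
... | yes _ = cong suc (count-complement (λ i → P? (suc i)))
... | no _  = trans (ℕₚ.+-suc (count (λ i → P? (suc i))) _)
                    (cong suc (count-complement (λ i → P? (suc i))))

count-all : ∀ {n} {P : Pred (Fin n) 0ℓ} (P? : Decidable P) → (∀ i → P i) → count P? ≡ n
count-all {zero}  P? all = refl
count-all {suc n} P? all with P? zero
... | yes _ = cong suc (count-all (λ i → P? (suc i)) (λ i → all (suc i)))
... | no ¬p = ⊥-elim (¬p (all zero))

count-remove : ∀ {n} {P Q : Pred (Fin n) 0ℓ} (P? : Decidable P) (Q? : Decidable Q) (z : Fin n) →
               (∀ i → Q i ⇔' (P i × i ≢ z)) → P z → count P? ≡ suc (count Q?)
count-remove {suc n} {P} {Q} P? Q? zero Q⇔ Pz with P? zero | Q? zero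
... | no ¬Pz | _           = ⊥-elim (¬Pz Pz)
... | yes _  | yes Q0      = ⊥-elim (proj₂ (proj₁ (Q⇔ zero) Q0) refl)
... | yes _  | no _        = cong suc (count-cong (λ i → P? (suc i)) (λ i → Q? (suc i)) P⇔Q)
  where
  P⇔Q : ∀ i → P (suc i) ⇔' Q (suc i)
  P⇔Q i = (λ Pi → proj₂ (Q⇔ (suc i)) (Pi , λ ())) , (λ Qi → proj₁ (proj₁ (Q⇔ (suc i)) Qi))
count-remove {suc n} {P} {Q} P? Q? (suc z) Q⇔ Pz = begin
  indicator (P? zero) ℕ.+ count (λ i → P? (suc i))        ≡⟨ cong₂ ℕ._+_ P0 rest ⟩
  indicator (Q? zero) ℕ.+ suc (count (λ i → Q? (suc i)))  ≡⟨ ℕₚ.+-suc (indicator (Q? zero)) _ ⟩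
  suc (count Q?)                                          ∎
  where
  open ≡-Reasoning
  P0 : indicator (P? zero) ≡ indicator (Q? zero)
  P0 = indicator-cong (P? zero) (Q? zero) ((λ P0 → proj₂ (Q⇔ zero) (P0 , λ ())) , (λ Q0 → proj₁ (proj₁ (Q⇔ zero) Q0)))
  Q⇔' : ∀ i → Q (suc i) ⇔' (P (suc i) × i ≢ z)
  Q⇔' i = (λ Qi → proj₁ (proj₁ (Q⇔ (suc i)) Qi) , λ { refl → proj₂ (proj₁ (Q⇔ (suc i)) Qi) refl })
        , (λ { (Pi , i≢z) → proj₂ (Q⇔ (suc i)) (Pi , λ eq → i≢z (Finₚ.suc-injective eq)) })
  rest : count (λ i → P? (suc i)) ≡ suc (count (λ i → Q? (suc i)))
  rest = count-remove (λ i → P? (suc i)) (λ i → Q? (suc i)) z Q⇔' Pz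

length-filter-tabulate : ∀ {n} {A : Set} {P : Pred A 0ℓ} (P? : Decidable P) (g : Fin n → A) →
                         length (filter P? (tabulate g)) ≡ count (λ i → P? (g i))
length-filter-tabulate {zero}  P? g = refl
length-filter-tabulate {suc n} P? g with P? (g zero)
... | yes _ = cong suc (length-filter-tabulate P? (λ i → g (suc i)))
... | no _  = length-filter-tabulate P? (λ i → g (suc i))

subset : ∀ {n} {P : Pred (Fin n) 0ℓ} → Decidable P → Subset n
subset P? = Vec.tabulate (λ i → ⌊ P? i ⌋)

∣subset∣ : ∀ {n} {P : Pred (Fin n) 0ℓ} (P? : Decidable P) → ∣ subset P? ∣ ≡ count P?
∣subset∣ {zero}  P? = refl
∣subset∣ {suc n} P? with P? zero
... | yes _ = cong suc (∣subset∣ (λ i → P? (suc i)))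
... | no _  = ∣subset∣ (λ i → P? (suc i))

∈-subset : ∀ {n} {P : Pred (Fin n) 0ℓ} (P? : Decidable P) i → i ∈ subset P? ⇔' P i
∈-subset P? i =
    (λ i∈ → ⌊⌋-sound (P? i) (trans (sym (Vecₚ.lookup∘tabulate _ i)) (Vecₚ.[]=⇒lookup i∈)))
  , (λ Pi → Vecₚ.lookup⇒[]= i _ (trans (Vecₚ.lookup∘tabulate _ i) (⌊⌋-complete (P? i) Pi)))

subset-cong : ∀ {n} {P Q : Pred (Fin n) 0ℓ} (P? : Decidable P) (Q? : Decidable Q) →
              (∀ i → P i ⇔' Q i) → subset P? ≡ subset Q?
subset-cong P? Q? P⇔Q = Vecₚ.tabulate-cong (λ i → ⌊⌋-cong (P? i) (Q? i) (P⇔Q i))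

subset-injective : ∀ {n} {P Q : Pred (Fin n) 0ℓ} (P? : Decidable P) (Q? : Decidable Q) →
                   subset P? ≡ subset Q? → ∀ i → P i → Q i
subset-injective P? Q? eq i Pi = proj₁ (∈-subset Q? i) (subst (i ∈_) eq (proj₂ (∈-subset P? i) Pi))

injective⇒surjective : ∀ {n} (f : Fin n → Fin n) → (∀ {a b} → f a ≡ f b → a ≡ b) →
                       ∀ y → ∃ λ x → f x ≡ y
injective⇒surjective {suc n} f inj y with Finₚ.any? (λ x → f x Finₚ.≟ y)
... | yes hit = hit
... | no miss = ⊥-elim (ℕₚ.1+n≰n (Finₚ.injective⇒≤ {f = avoidY} avoidY-injective))
  where
  -- f never hits y, so it factors through Fin n with y punched out
  avoidY : Fin (suc n) → Fin n
  avoidY x = punchOut {i = y} {j = f x} (λ eq → miss (x , sym eq))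
  avoidY-injective : ∀ {a b} → avoidY a ≡ avoidY b → a ≡ b
  avoidY-injective {a} {b} eq =
    inj (Finₚ.punchOut-injective (λ eq → miss (a , sym eq)) (λ eq → miss (b , sym eq)) eq)

-- Dually, a surjective endomap of Fin n is injective: its chosen section is
-- injective, hence surjective, hence f is the inverse of a bijection.
surjective⇒injective : ∀ {n} (f : Fin n → Fin n) → (∀ y → ∃ λ x → f x ≡ y) →
                       ∀ {a b} → f a ≡ f b → a ≡ b
surjective⇒injective {n} f surj {a} {b} fa≡fb = begin
  a                    ≡⟨ sym (proj₂ (section-onto a)) ⟩
  section (preimage a) ≡⟨ cong section preimage-eq ⟩
  section (preimage b) ≡⟨ proj₂ (section-onto b) ⟩
  b                    ∎
  where
  open ≡-Reasoning
  section : Fin n → Fin n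
  section y = proj₁ (surj y)
  section-injective : ∀ {x y} → section x ≡ section y → x ≡ y
  section-injective {x} {y} eq = trans (sym (proj₂ (surj x))) (trans (cong f eq) (proj₂ (surj y)))
  section-onto : ∀ x → ∃ λ y → section y ≡ x
  section-onto = injective⇒surjective section section-injective
  preimage : Fin n → Fin n
  preimage x = proj₁ (section-onto x)
  f≡preimage : ∀ x → f x ≡ preimage x
  f≡preimage x = trans (cong f (sym (proj₂ (section-onto x)))) (proj₂ (surj (preimage x)))
  preimage-eq : preimage a ≡ preimage b
  preimage-eq = trans (sym (f≡preimage a)) (trans fa≡fb (f≡preimage b))

module FiniteFieldFacts {q : ℕ} (F : FiniteField q) where
  open FiniteField F public renaming (_^_ to _^ᶠ_)
  open IsCommutativeRing isCommutativeRing public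
    using (+-comm; +-assoc; +-identityˡ; +-identityʳ; *-comm; *-assoc;
           *-identityˡ; *-identityʳ; zeroˡ; zeroʳ; distribˡ; distribʳ; -‿inverseʳ)
  open ≡-Reasoning

  commutativeRing : CommutativeRing 0ℓ 0ℓ
  commutativeRing = record { isCommutativeRing = isCommutativeRing }

  almostCommutativeRing : AlmostCommutativeRing 0ℓ 0ℓ
  almostCommutativeRing = fromCommutativeRing commutativeRing (λ _ → nothing)

  module Ring = AlmostCommutativeRing almostCommutativeRing

  *-interchange : ∀ a b c d → (a * b) * (c * d) ≡ (a * c) * (b * d)
  *-interchange = solved
    where
    solved : ∀ a b c d → (a Ring.* b) Ring.* (c Ring.* d) ≡ (a Ring.* c) Ring.* (b Ring.* d)
    solved = solve-∀ almostCommutativeRing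

  +-interchange : ∀ a b c d → (a + b) + (c + d) ≡ (a + c) + (b + d)
  +-interchange = solved
    where
    solved : ∀ a b c d → (a Ring.+ b) Ring.+ (c Ring.+ d) ≡ (a Ring.+ c) Ring.+ (b Ring.+ d)
    solved = solve-∀ almostCommutativeRing

  neg-square : ∀ x → (- x) * (- x) ≡ x * x
  neg-square x = begin
    (- x) * (- x)    ≡⟨ sym (RingProperties.-‿distribˡ-* x (- x)) ⟩
    - (x * (- x))    ≡⟨ cong -_ (sym (RingProperties.-‿distribʳ-* x x)) ⟩
    - (- (x * x))    ≡⟨ RingProperties.-‿involutive (x * x) ⟩
    x * x            ∎
    where
    module RingProperties = Algebra.Properties.Ring (CommutativeRing.ring commutativeRing)

  square-sum : ∀ x y → (x + y) * (x + y) ≡ (x * x + y * y) + (x * y + x * y)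
  square-sum = solved
    where
    solved : ∀ x y → (x Ring.+ y) Ring.* (x Ring.+ y) ≡ (x Ring.* x Ring.+ y Ring.* y) Ring.+ (x Ring.* y Ring.+ x Ring.* y)
    solved = solve-∀ almostCommutativeRing

  1≢0 : 1# ≢ 0#
  1≢0 eq = 0≢1 (sym eq)

  -- A total inverse function, with 0⁻¹ = 0.
  _⁻¹ : Fin q → Fin q
  x ⁻¹ with x Finₚ.≟ 0#
  ... | yes _  = 0#
  ... | no x≢0 = proj₁ (inverse x x≢0)

  ⁻¹-inverseʳ : ∀ {x} → x ≢ 0# → x * x ⁻¹ ≡ 1#
  ⁻¹-inverseʳ {x} x≢0 with x Finₚ.≟ 0#
  ... | yes x≡0 = ⊥-elim (x≢0 x≡0)
  ... | no x≢0  = proj₂ (inverse x x≢0)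

  ⁻¹-inverseˡ : ∀ {x} → x ≢ 0# → x ⁻¹ * x ≡ 1#
  ⁻¹-inverseˡ {x} x≢0 = trans (*-comm (x ⁻¹) x) (⁻¹-inverseʳ x≢0)

  0⁻¹ : 0# ⁻¹ ≡ 0#
  0⁻¹ with 0# Finₚ.≟ 0#
  ... | yes _   = refl
  ... | no 0≢0  = ⊥-elim (0≢0 refl)

  *-⁻¹-cancel : ∀ t {x} → x ≢ 0# → (t * x) * x ⁻¹ ≡ t
  *-⁻¹-cancel t {x} x≢0 = trans (*-assoc t x (x ⁻¹)) (trans (cong (t *_) (⁻¹-inverseʳ x≢0)) (*-identityʳ t))

  ⁻¹-*-cancel : ∀ t {x} → x ≢ 0# → (t * x ⁻¹) * x ≡ t
  ⁻¹-*-cancel t {x} x≢0 = trans (*-assoc t (x ⁻¹) x) (trans (cong (t *_) (⁻¹-inverseˡ x≢0)) (*-identityʳ t))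

  zero-divisor : ∀ x y → x * y ≡ 0# → x ≡ 0# ⊎ y ≡ 0#
  zero-divisor x y xy≡0 with x Finₚ.≟ 0#
  ... | yes x≡0 = inj₁ x≡0
  ... | no x≢0  = inj₂ (begin
    y                ≡⟨ sym (⁻¹-*-cancel y x≢0) ⟩
    (y * x ⁻¹) * x   ≡⟨ cong (_* x) (*-comm y (x ⁻¹)) ⟩
    (x ⁻¹ * y) * x   ≡⟨ *-assoc (x ⁻¹) y x ⟩
    x ⁻¹ * (y * x)   ≡⟨ cong (x ⁻¹ *_) (trans (*-comm y x) xy≡0) ⟩
    x ⁻¹ * 0#        ≡⟨ zeroʳ (x ⁻¹) ⟩
    0#               ∎)

  *-≢0 : ∀ {x y} → x ≢ 0# → y ≢ 0# → x * y ≢ 0#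
  *-≢0 {x} {y} x≢0 y≢0 xy≡0 with zero-divisor x y xy≡0
  ... | inj₁ x≡0 = x≢0 x≡0
  ... | inj₂ y≡0 = y≢0 y≡0

  ⁻¹-≢0 : ∀ {x} → x ≢ 0# → x ⁻¹ ≢ 0#
  ⁻¹-≢0 {x} x≢0 x⁻¹≡0 = 1≢0 (trans (sym (⁻¹-inverseʳ x≢0)) (trans (cong (x *_) x⁻¹≡0) (zeroʳ x)))

  *-cancelʳ : ∀ a b {c} → c ≢ 0# → a * c ≡ b * c → a ≡ b
  *-cancelʳ a b {c} c≢0 eq = begin
    a                ≡⟨ sym (*-⁻¹-cancel a c≢0) ⟩
    (a * c) * c ⁻¹   ≡⟨ cong (_* c ⁻¹) eq ⟩
    (b * c) * c ⁻¹   ≡⟨ *-⁻¹-cancel b c≢0 ⟩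
    b                ∎

  ⁻¹-involutive : ∀ {x} → x ≢ 0# → (x ⁻¹) ⁻¹ ≡ x
  ⁻¹-involutive {x} x≢0 =
    *-cancelʳ ((x ⁻¹) ⁻¹) x (⁻¹-≢0 x≢0) (trans (⁻¹-inverseˡ (⁻¹-≢0 x≢0)) (sym (⁻¹-inverseʳ x≢0)))

  module Product = MonoidSum (CommutativeRing.*-commutativeMonoid commutativeRing)

  ∏ : ∀ {n} → (Fin n → Fin q) → Fin q
  ∏ = Product.sum

  ∏-const : ∀ n x → ∏ {n} (λ _ → x) ≡ x ^ᶠ n
  ∏-const zero    x = refl
  ∏-const (suc n) x = cong (x *_) (∏-const n x)

  ∏-scale : ∀ {n} x (g : Fin n → Fin q) → ∏ (λ i → x * g i) ≡ x ^ᶠ n * ∏ g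
  ∏-scale {n} x g = trans (Product.∑-distrib-+ (λ _ → x) g) (cong (_* ∏ g) (∏-const n x))

  ∏-scale-at : ∀ {n} x (e d : Fin n → Fin q) (i : Fin n) →
               (∀ j → j ≢ i → e j ≡ d j) → e i ≡ x * d i → ∏ e ≡ x * ∏ d
  ∏-scale-at {suc n} x e d i agree ei≡xdi = begin
    ∏ e                                 ≡⟨ Product.sum-remove e ⟩
    e i * ∏ (λ j → e (punchIn i j))     ≡⟨ cong₂ _*_ ei≡xdi (Product.sum-cong-≗ λ j → agree _ (Finₚ.punchInᵢ≢i i j)) ⟩
    (x * d i) * ∏ (λ j → d (punchIn i j)) ≡⟨ *-assoc x (d i) _ ⟩
    x * (d i * ∏ (λ j → d (punchIn i j))) ≡⟨ cong (x *_) (sym (Product.sum-remove d)) ⟩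
    x * ∏ d                             ∎

  ∏-≢0 : ∀ {n} (g : Fin n → Fin q) → (∀ i → g i ≢ 0#) → ∏ g ≢ 0#
  ∏-≢0 {zero}  g g≢0 = 1≢0
  ∏-≢0 {suc n} g g≢0 = *-≢0 (g≢0 zero) (∏-≢0 (λ i → g (suc i)) (λ i → g≢0 (suc i)))

  -- Fermat's little theorem: x^q = x.  For x ≠ 0, multiplication by x
  -- permutes the field; compare the products of all elements (with 0
  -- replaced by 1) before and after this permutation.
  fermat : ∀ x → x ^ᶠ q ≡ x
  fermat x with x Finₚ.≟ 0#
  ... | yes refl = power-of-0 q 0#
    where
    power-of-0 : ∀ n → Fin n → 0# ^ᶠ n ≡ 0#
    power-of-0 (suc n) _ = zeroˡ (0# ^ᶠ n)
  ... | no x≢0 = *-cancelʳ (x ^ᶠ q) x (∏-≢0 unit unit-≢0) (begin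
    x ^ᶠ q * ∏ unit              ≡⟨ sym (∏-scale x unit) ⟩
    ∏ (λ a → x * unit a)        ≡⟨ ∏-scale-at x (λ a → x * unit a) (λ a → unit (x * a)) 0# agree at-0 ⟩
    x * ∏ (λ a → unit (x * a))  ≡⟨ cong (x *_) (sym (Product.sum-permute unit multiplication-by-x)) ⟩
    x * ∏ unit                  ∎)
    where
    unit : Fin q → Fin q
    unit a with a Finₚ.≟ 0#
    ... | yes _ = 1#
    ... | no _  = a
    unit-≢0 : ∀ a → unit a ≢ 0#
    unit-≢0 a with a Finₚ.≟ 0#
    ... | yes _   = 1≢0
    ... | no a≢0  = a≢0
    unit-nonzero : ∀ {a} → a ≢ 0# → unit a ≡ a
    unit-nonzero {a} a≢0 with a Finₚ.≟ 0#
    ... | yes a≡0 = ⊥-elim (a≢0 a≡0)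
    ... | no _    = refl
    agree : ∀ a → a ≢ 0# → x * unit a ≡ unit (x * a)
    agree a a≢0 = trans (cong (x *_) (unit-nonzero a≢0)) (sym (unit-nonzero (*-≢0 x≢0 a≢0)))
    at-0 : x * unit 0# ≡ x * unit (x * 0#)
    at-0 = cong (λ t → x * unit t) (sym (zeroʳ x))
    multiplication-by-x : Permutation q q
    multiplication-by-x = permutation (x *_) (x ⁻¹ *_)
      (λ y → trans (sym (*-assoc x (x ⁻¹) y)) (trans (cong (_* y) (⁻¹-inverseʳ x≢0)) (*-identityˡ y)))
      (λ y → trans (sym (*-assoc (x ⁻¹) x y)) (trans (cong (_* y) (⁻¹-inverseˡ x≢0)) (*-identityˡ y)))

  order≥2 : ∃[ r ] (q ≡ suc (suc r))
  order≥2 = two-elements 0# 1# 0≢1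
    where
    two-elements : ∀ {n} (a b : Fin n) → a ≢ b → ∃[ r ] (n ≡ suc (suc r))
    two-elements {suc zero}    zero zero a≢b = ⊥-elim (a≢b refl)
    two-elements {suc (suc r)} _    _    _   = r , refl

  power-inverse : ∀ {x} → x ≢ 0# → ∃[ r ] (x ^ᶠ r * x ≡ 1#)
  power-inverse {x} x≢0 with order≥2
  ... | r , q≡2+r = r , *-cancelʳ (x ^ᶠ r * x) 1# x≢0 (begin
    (x ^ᶠ r * x) * x    ≡⟨ trans (*-assoc (x ^ᶠ r) x x) (*-comm (x ^ᶠ r) (x * x)) ⟩
    (x * x) * x ^ᶠ r    ≡⟨ *-assoc x x (x ^ᶠ r) ⟩
    x ^ᶠ suc (suc r)    ≡⟨ subst (λ n → x ^ᶠ n ≡ x) q≡2+r (fermat x) ⟩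
    x                  ≡⟨ sym (*-identityˡ x) ⟩
    1# * x             ∎)

  ^-double : ∀ x j → x ^ᶠ (j ℕ.+ j) ≡ (x * x) ^ᶠ j
  ^-double x zero    = refl
  ^-double x (suc j) = begin
    x * x ^ᶠ (j ℕ.+ suc j)      ≡⟨ cong (λ n → x * x ^ᶠ n) (ℕₚ.+-suc j j) ⟩
    x * (x * x ^ᶠ (j ℕ.+ j))    ≡⟨ sym (*-assoc x x _) ⟩
    (x * x) * x ^ᶠ (j ℕ.+ j)    ≡⟨ cong ((x * x) *_) (^-double x j) ⟩
    (x * x) * (x * x) ^ᶠ j      ∎

  1^ᶠ : ∀ j → 1# ^ᶠ j ≡ 1#
  1^ᶠ zero    = refl
  1^ᶠ (suc j) = trans (*-identityˡ (1# ^ᶠ j)) (1^ᶠ j)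

  -- case split on being zero, without abstracting over x ≟ 0#
  zero-or-nonzero : ∀ x → x ≡ 0# ⊎ x ≢ 0#
  zero-or-nonzero x with x Finₚ.≟ 0#
  ... | yes x≡0 = inj₁ x≡0
  ... | no x≢0  = inj₂ x≢0

-- Fields of order 2^(k+1): characteristic 2 and the Frobenius map.
module BinaryFieldFacts (k : ℕ) (F : FiniteField (2 ^ suc k)) where
  open FiniteFieldFacts F public
  open ≡-Reasoning

  q : ℕ
  q = 2 ^ suc k

  q≡K+K : q ≡ 2 ^ k ℕ.+ 2 ^ k
  q≡K+K = cong (2 ^ k ℕ.+_) (ℕₚ.+-identityʳ (2 ^ k))

  -- Characteristic 2: -1 = (-1)^(2^(k+1)) = ((-1)²)^(2^k) = 1.
  -1≡1 : - 1# ≡ 1#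
  -1≡1 = begin
    - 1#                          ≡⟨ sym (fermat (- 1#)) ⟩
    (- 1#) ^ᶠ (K ℕ.+ (K ℕ.+ 0))   ≡⟨ cong ((- 1#) ^ᶠ_) (cong (K ℕ.+_) (ℕₚ.+-identityʳ K)) ⟩
    (- 1#) ^ᶠ (K ℕ.+ K)           ≡⟨ ^-double (- 1#) K ⟩
    ((- 1#) * (- 1#)) ^ᶠ K        ≡⟨ cong (_^ᶠ K) (trans (neg-square 1#) (*-identityˡ 1#)) ⟩
    1# ^ᶠ K                       ≡⟨ 1^ᶠ K ⟩
    1#                            ∎
    where
    K : ℕ
    K = 2 ^ k

  x+x≡0 : ∀ x → x + x ≡ 0#
  x+x≡0 x = begin
    x + x              ≡⟨ cong₂ _+_ (sym (*-identityʳ x)) (sym (*-identityʳ x)) ⟩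
    x * 1# + x * 1#    ≡⟨ sym (distribˡ x 1# 1#) ⟩
    x * (1# + 1#)      ≡⟨ cong (λ t → x * (1# + t)) (sym -1≡1) ⟩
    x * (1# + - 1#)    ≡⟨ cong (x *_) (-‿inverseʳ 1#) ⟩
    x * 0#             ≡⟨ zeroʳ x ⟩
    0#                 ∎

  +-cancelʳ-self : ∀ a b → (a + b) + b ≡ a
  +-cancelʳ-self a b = trans (+-assoc a b b) (trans (cong (a +_) (x+x≡0 b)) (+-identityʳ a))

  +-cancelˡ-self : ∀ a b → a + (a + b) ≡ b
  +-cancelˡ-self a b = trans (sym (+-assoc a a b)) (trans (cong (_+ b) (x+x≡0 a)) (+-identityˡ b))

  sum≡0⇒≡ : ∀ {x y} → x + y ≡ 0# → x ≡ y
  sum≡0⇒≡ {x} {y} x+y≡0 = trans (sym (+-cancelʳ-self x y)) (trans (cong (_+ y) x+y≡0) (+-identityˡ y))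

  -- The Frobenius map x ↦ x^(2^j), computed by j successive squarings.
  frob : ℕ → Fin q → Fin q
  frob zero    x = x
  frob (suc j) x = frob j (x * x)

  frob-pow : ∀ j x → x ^ᶠ (2 ^ j) ≡ frob j x
  frob-pow zero    x = *-identityʳ x
  frob-pow (suc j) x = begin
    x ^ᶠ (2 ^ j ℕ.+ (2 ^ j ℕ.+ 0))  ≡⟨ cong (λ n → x ^ᶠ (2 ^ j ℕ.+ n)) (ℕₚ.+-identityʳ (2 ^ j)) ⟩
    x ^ᶠ (2 ^ j ℕ.+ 2 ^ j)          ≡⟨ ^-double x (2 ^ j) ⟩
    (x * x) ^ᶠ (2 ^ j)              ≡⟨ frob-pow j (x * x) ⟩
    frob j (x * x)                  ∎

  frob-* : ∀ j x y → frob j (x * y) ≡ frob j x * frob j y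
  frob-* zero    x y = refl
  frob-* (suc j) x y = trans (cong (frob j) (*-interchange x y x y)) (frob-* j (x * x) (y * y))

  -- Squaring is additive in characteristic 2, hence so is every frob j.
  frob-+ : ∀ j x y → frob j (x + y) ≡ frob j x + frob j y
  frob-+ zero    x y = refl
  frob-+ (suc j) x y = trans (cong (frob j) square-additive) (frob-+ j (x * x) (y * y))
    where
    square-additive : (x + y) * (x + y) ≡ x * x + y * y
    square-additive = trans (square-sum x y) (trans (cong (_ +_) (x+x≡0 (x * y))) (+-identityʳ _))

  frob-0 : ∀ j → frob j 0# ≡ 0#
  frob-0 zero    = refl
  frob-0 (suc j) = trans (cong (frob j) (zeroʳ 0#)) (frob-0 j)

  frob-1 : ∀ j → frob j 1# ≡ 1#
  frob-1 zero    = refl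
  frob-1 (suc j) = trans (cong (frob j) (*-identityʳ 1#)) (frob-1 j)

  frob-comp : ∀ i j x → frob (i ℕ.+ j) x ≡ frob j (frob i x)
  frob-comp zero    j x = refl
  frob-comp (suc i) j x = frob-comp i j (x * x)

  frob-≡0 : ∀ j {x} → frob j x ≡ 0# → x ≡ 0#
  frob-≡0 zero    eq = eq
  frob-≡0 (suc j) {x} eq with zero-divisor x x (frob-≡0 j eq)
  ... | inj₁ x≡0 = x≡0
  ... | inj₂ x≡0 = x≡0

  frob-≢0 : ∀ j {x} → x ≢ 0# → frob j x ≢ 0#
  frob-≢0 j x≢0 fx≡0 = x≢0 (frob-≡0 j fx≡0)

  frob-injective : ∀ j {x y} → frob j x ≡ frob j y → x ≡ y
  frob-injective j {x} {y} eq =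
    sum≡0⇒≡ (frob-≡0 j (trans (frob-+ j x y) (trans (cong (_+ frob j y) eq) (x+x≡0 (frob j y)))))

  frob-period : ∀ x → frob (suc k) x ≡ x
  frob-period x = trans (sym (frob-pow (suc k) x)) (fermat x)

  frob-iterate : ∀ j z → frob j z ≡ z → ∀ i → frob (i ℕ.* j) z ≡ z
  frob-iterate j z fixed zero    = refl
  frob-iterate j z fixed (suc i) =
    trans (frob-comp j (i ℕ.* j) z) (trans (cong (frob (i ℕ.* j)) fixed) (frob-iterate j z fixed i))

  -- If gcd(h, k+1) = 1, the only fixed points of frob h are those of
  -- squaring (Bézout), namely 0 and 1.
  frob-fixed-points : ∀ h → gcd h (suc k) ≡ 1 → ∀ z → frob h z ≡ z → z ≡ 0# ⊎ z ≡ 1#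
  frob-fixed-points h coprime z fixed with zero-divisor z (z + 1#) z[z+1]≡0
    where
    m : ℕ
    m = suc k
    squaring-fixes : Bézout.Identity.Identity 1 h m → z * z ≡ z
    squaring-fixes (Bézout.Identity.+- a b 1+bm≡ah) = begin
      z * z                    ≡⟨ sym (frob-iterate m (z * z) (frob-period (z * z)) b) ⟩
      frob (b ℕ.* m) (z * z)   ≡⟨ cong (λ n → frob n z) 1+bm≡ah ⟩
      frob (a ℕ.* h) z         ≡⟨ frob-iterate h z fixed a ⟩
      z                        ∎
    squaring-fixes (Bézout.Identity.-+ a b 1+ah≡bm) = begin
      z * z                    ≡⟨ sym (frob-iterate h (z * z) (trans (frob-* h z z) (cong₂ _*_ fixed fixed)) a) ⟩
      frob (a ℕ.* h) (z * z)   ≡⟨ cong (λ n → frob n z) 1+ah≡bm ⟩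
      frob (b ℕ.* m) z         ≡⟨ frob-iterate m z (frob-period z) b ⟩
      z                        ∎
    z[z+1]≡0 : z * (z + 1#) ≡ 0#
    z[z+1]≡0 = trans (distribˡ z z 1#)
      (trans (cong₂ _+_ (squaring-fixes (Bézout.identity (subst (GCD h m) coprime (gcd-GCD h m)))) (*-identityʳ z))
             (x+x≡0 z))
  ... | inj₁ z≡0   = inj₁ z≡0
  ... | inj₂ z+1≡0 = inj₂ (sum≡0⇒≡ z+1≡0)

  frob-fixed-nonzero : ∀ h → gcd h (suc k) ≡ 1 → ∀ {z} → z ≢ 0# → frob h z ≡ z → z ≡ 1#
  frob-fixed-nonzero h coprime {z} z≢0 fixed with frob-fixed-points h coprime z fixed
  ... | inj₁ z≡0 = ⊥-elim (z≢0 z≡0)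
  ... | inj₂ z≡1 = z≡1

-- The F₂-linear map L(s) = s^(2^h) + s on GF(2^(k+1)) with gcd(h, k+1) = 1,
-- and its image T, which turns out to be a hyperplane.
module Hyperplane (k h : ℕ) (F : FiniteField (2 ^ suc k)) (coprime : gcd h (suc k) ≡ 1) where
  open BinaryFieldFacts k F public
  open ≡-Reasoning

  L : Fin q → Fin q
  L s = frob h s + s

  L-+ : ∀ a b → L (a + b) ≡ L a + L b
  L-+ a b = trans (cong (_+ (a + b)) (frob-+ h a b)) (+-interchange (frob h a) (frob h b) a b)

  L-0 : L 0# ≡ 0#
  L-0 = trans (cong (_+ 0#) (frob-0 h)) (+-identityʳ 0#)

  L-1 : L 1# ≡ 0#
  L-1 = trans (cong (_+ 1#) (frob-1 h)) (x+x≡0 1#)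

  -- The kernel of L is {0, 1}, so each fibre of L is a pair {s, s + 1}.
  L-fibre : ∀ a b → L a ≡ L b → b ≡ a ⊎ b ≡ a + 1#
  L-fibre a b La≡Lb with frob-fixed-points h coprime (a + b) (sum≡0⇒≡ L[a+b]≡0)
    where
    L[a+b]≡0 : L (a + b) ≡ 0#
    L[a+b]≡0 = trans (L-+ a b) (trans (cong (_+ L b) La≡Lb) (x+x≡0 (L b)))
  ... | inj₁ a+b≡0 = inj₁ (sym (sum≡0⇒≡ a+b≡0))
  ... | inj₂ a+b≡1 = inj₂ (trans (sym (+-cancelˡ-self a b)) (cong (a +_) a+b≡1))

  T : Fin q → Set
  T y = ∃ λ s → L s ≡ y

  T? : Decidable T
  T? y = Finₚ.any? (λ s → L s Finₚ.≟ y)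

  T-0 : T 0#
  T-0 = 0# , L-0

  T-+ : ∀ {a b} → T a → T b → T (a + b)
  T-+ (s , Ls≡a) (t , Lt≡b) = s + t , trans (L-+ s t) (cong₂ _+_ Ls≡a Lt≡b)

  -- L is not injective, so by finiteness not surjective: fix e ∉ T.
  outside : ∃ λ e → ¬ T e
  outside with Finₚ.any? (λ y → ¬? (T? y))
  ... | yes missed = missed
  ... | no ¬missed = ⊥-elim (0≢1 (surjective⇒injective L onto (trans L-0 (sym L-1))))
    where
    onto : ∀ y → T y
    onto y with T? y
    ... | yes Ty = Ty
    ... | no ¬Ty = ⊥-elim (¬missed (y , ¬Ty))

  e : Fin q
  e = proj₁ outside

  e∉T : ¬ T e
  e∉T = proj₂ outside

  -- T has index 2: every y lies in exactly one of T and T + e.  Choosing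
  -- from each fibre {s, s+1} of L the smaller element, the map Φ sending it
  -- to L s and the larger one to L s + e is injective, hence surjective.
  private
    Φ : Fin q → Fin q
    Φ s with s Finₚ.<? s + 1#
    ... | yes _ = L s
    ... | no _  = L s + e

    Φ-cases : ∀ s → (s < s + 1# × Φ s ≡ L s) ⊎ (¬ s < s + 1# × Φ s ≡ L s + e)
    Φ-cases s with s Finₚ.<? s + 1#
    ... | yes s<s+1 = inj₁ (s<s+1 , refl)
    ... | no s≮s+1  = inj₂ (s≮s+1 , refl)

    s≢s+1 : ∀ s → s ≢ s + 1#
    s≢s+1 s eq = 1≢0 (trans (sym (+-cancelˡ-self s 1#)) (trans (cong (_+ (s + 1#)) eq) (x+x≡0 (s + 1#))))

    mixed : ∀ a b → L a + L b ≢ e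
    mixed a b eq = e∉T (a + b , trans (L-+ a b) eq)

    Φ-injective : ∀ {a b} → Φ a ≡ Φ b → a ≡ b
    Φ-injective {a} {b} eq with Φ-cases a | Φ-cases b
    ... | inj₁ (a<a+1 , Φa) | inj₁ (b<b+1 , Φb) with L-fibre a b (trans (sym Φa) (trans eq Φb))
    ...   | inj₁ b≡a   = sym b≡a
    ...   | inj₂ refl  = ⊥-elim (Finₚ.<-asym a<a+1 (subst (a + 1# <_) (+-cancelʳ-self a 1#) b<b+1))
    Φ-injective {a} {b} eq | inj₂ (a≮a+1 , Φa) | inj₂ (b≮b+1 , Φb)
      with L-fibre a b (trans (sym (+-cancelʳ-self (L a) e)) (trans (cong (_+ e) (trans (sym Φa) (trans eq Φb))) (+-cancelʳ-self (L b) e)))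
    ...   | inj₁ b≡a   = sym b≡a
    ...   | inj₂ refl with Finₚ.<-cmp a (a + 1#)
    ...     | tri< a<a+1 _ _ = ⊥-elim (a≮a+1 a<a+1)
    ...     | tri≈ _ a≡a+1 _ = ⊥-elim (s≢s+1 a a≡a+1)
    ...     | tri> _ _ a+1<a = ⊥-elim (b≮b+1 (subst (a + 1# <_) (sym (+-cancelʳ-self a 1#)) a+1<a))
    Φ-injective {a} {b} eq | inj₁ (_ , Φa) | inj₂ (_ , Φb) = ⊥-elim (mixed a b (begin
      L a + L b           ≡⟨ cong (_+ L b) (trans (sym Φa) (trans eq Φb)) ⟩
      (L b + e) + L b     ≡⟨ cong (_+ L b) (+-comm (L b) e) ⟩
      (e + L b) + L b     ≡⟨ +-cancelʳ-self e (L b) ⟩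
      e                   ∎))
    Φ-injective {a} {b} eq | inj₂ (_ , Φa) | inj₁ (_ , Φb) = ⊥-elim (mixed a b (begin
      L a + L b           ≡⟨ cong (L a +_) (trans (sym Φb) (trans (sym eq) Φa)) ⟩
      L a + (L a + e)     ≡⟨ +-cancelˡ-self (L a) e ⟩
      e                   ∎))

  index-two : ∀ y → T y ⊎ T (y + e)
  index-two y with injective⇒surjective Φ Φ-injective y
  ... | s , Φs≡y with Φ-cases s
  ...   | inj₁ (_ , Φs≡Ls)   = inj₁ (s , trans (sym Φs≡Ls) Φs≡y)
  ...   | inj₂ (_ , Φs≡Ls+e) = inj₂ (s , trans (sym (+-cancelʳ-self (L s) e)) (cong (_+ e) (trans (sym Φs≡Ls+e) Φs≡y)))

  not-both : ∀ {y} → T y → ¬ T (y + e)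
  not-both {y} Ty Ty+e = e∉T (subst T (+-cancelˡ-self y e) (T-+ Ty Ty+e))

  outside-+ : ∀ {a b} → ¬ T a → ¬ T b → T (a + b)
  outside-+ {a} {b} a∉T b∉T with index-two a | index-two b
  ... | inj₁ a∈T | _        = ⊥-elim (a∉T a∈T)
  ... | _        | inj₁ b∈T = ⊥-elim (b∉T b∈T)
  ... | inj₂ a+e∈T | inj₂ b+e∈T = subst T a+e+b+e≡a+b (T-+ a+e∈T b+e∈T)
    where
    a+e+b+e≡a+b : (a + e) + (b + e) ≡ a + b
    a+e+b+e≡a+b = trans (+-interchange a e b e) (trans (cong ((a + b) +_) (x+x≡0 e)) (+-identityʳ (a + b)))

  -- |T| = q/2: the complement of T is its translate T + e.
  ∣T∣ : count T? ≡ 2 ^ k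
  ∣T∣ = ℕₚ.*-cancelˡ-≡ (count T?) (2 ^ k) 2 (begin
    2 ℕ.* count T?                 ≡⟨ cong (count T? ℕ.+_) (ℕₚ.+-identityʳ (count T?)) ⟩
    count T? ℕ.+ count T?          ≡⟨ cong (count T? ℕ.+_) (sym complement≡translate) ⟩
    count T? ℕ.+ count (λ y → ¬? (T? y)) ≡⟨ count-complement T? ⟩
    2 ℕ.* 2 ^ k                  ∎)
    where
    complement≡translate : count (λ y → ¬? (T? y)) ≡ count T?
    complement≡translate = begin
      count (λ y → ¬? (T? y))   ≡⟨ count-cong (λ y → ¬? (T? y)) (λ y → T? (y + e)) complement⇔translate ⟩
      count (λ y → T? (y + e))  ≡⟨ count-bijection T? (_+ e) (_+ e) (λ y → +-cancelʳ-self y e) (λ y → +-cancelʳ-self y e) ⟩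
      count T?                  ∎
      where
      complement⇔translate : ∀ y → (¬ T y) ⇔' T (y + e)
      complement⇔translate y = to , (λ y+e∈T y∈T → not-both y∈T y+e∈T)
        where
        to : ¬ T y → T (y + e)
        to y∉T with index-two y
        ... | inj₁ y∈T   = ⊥-elim (y∉T y∈T)
        ... | inj₂ y+e∈T = y+e∈T

  -- Only the multiplier 1 maps T onto itself.  Otherwise d = c + 1 ≠ 0
  -- also maps T into T, and d e = c e + e ∈ T as c e ∉ T; since d⁻¹ is a
  -- power of d this would give e ∈ T.
  stabiliser : ∀ c → (∀ t → T t ⇔' T (c * t)) → c ≡ 1#
  stabiliser c c-stable with zero-or-nonzero (c + 1#)
  ... | inj₁ c+1≡0 = sum≡0⇒≡ c+1≡0
  ... | inj₂ d≢0 with power-inverse d≢0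
  ...   | r , dʳd≡1 = ⊥-elim (e∉T (subst T e-back (d^-stable r (outside-+ ce∉T e∉T))))
    where
    d : Fin q
    d = c + 1#
    d-stable : ∀ {t} → T t → T (d * t)
    d-stable {t} t∈T = subst T (sym dt≡ct+t) (T-+ (proj₁ (c-stable t) t∈T) t∈T)
      where
      dt≡ct+t : d * t ≡ c * t + t
      dt≡ct+t = trans (distribʳ t c 1#) (cong (c * t +_) (*-identityˡ t))
    d^-stable : ∀ j {t} → T t → T (d ^ᶠ j * t)
    d^-stable zero    {t} t∈T = subst T (sym (*-identityˡ t)) t∈T
    d^-stable (suc j) {t} t∈T = subst T (sym (*-assoc d (d ^ᶠ j) t)) (d-stable (d^-stable j t∈T))
    ce∉T : ¬ T (c * e)
    ce∉T ce∈T = e∉T (proj₂ (c-stable e) ce∈T)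
    e-back : d ^ᶠ r * (c * e + e) ≡ e
    e-back = begin
      d ^ᶠ r * (c * e + e)        ≡⟨ cong (d ^ᶠ r *_) (cong (c * e +_) (sym (*-identityˡ e))) ⟩
      d ^ᶠ r * (c * e + 1# * e)   ≡⟨ cong (d ^ᶠ r *_) (sym (distribʳ e c 1#)) ⟩
      d ^ᶠ r * (d * e)            ≡⟨ sym (*-assoc (d ^ᶠ r) d e) ⟩
      (d ^ᶠ r * d) * e            ≡⟨ cong (_* e) dʳd≡1 ⟩
      1# * e                      ≡⟨ *-identityˡ e ⟩
      e                           ∎

  everything-for-0 : ∀ {a} → a ≡ 0# → ∀ t → T (t * a)
  everything-for-0 {a} refl t = subst T (sym (zeroʳ t)) T-0

  not-everything : ∀ {a} → a ≢ 0# → ¬ (∀ t → T (t * a))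
  not-everything {a} a≢0 all = e∉T (subst T (⁻¹-*-cancel e a≢0) (all (e * a ⁻¹)))

  multiplier-injective : ∀ a a' → (∀ t → T (t * a) ⇔' T (t * a')) → a ≡ a'
  multiplier-injective a a' same with zero-or-nonzero a | zero-or-nonzero a'
  ... | inj₁ a≡0 | inj₁ a'≡0 = trans a≡0 (sym a'≡0)
  ... | inj₁ a≡0 | inj₂ a'≢0 = ⊥-elim (not-everything a'≢0 (λ t → proj₁ (same t) (everything-for-0 a≡0 t)))
  ... | inj₂ a≢0 | inj₁ a'≡0 = ⊥-elim (not-everything a≢0 (λ t → proj₂ (same t) (everything-for-0 a'≡0 t)))
  ... | inj₂ a≢0 | inj₂ a'≢0 = sym (*-cancelʳ a' a (⁻¹-≢0 a≢0) c≡1-scaled)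
    where
    c : Fin q
    c = a' * a ⁻¹
    rescale : ∀ t → (t * a ⁻¹) * a' ≡ c * t
    rescale t = trans (*-assoc t (a ⁻¹) a') (trans (*-comm t _) (cong (_* t) (*-comm (a ⁻¹) a')))
    c-stable : ∀ t → T t ⇔' T (c * t)
    c-stable t =
        (λ t∈T → subst T (rescale t) (proj₁ (same (t * a ⁻¹)) (subst T (sym (⁻¹-*-cancel t a≢0)) t∈T)))
      , (λ ct∈T → subst T (⁻¹-*-cancel t a≢0) (proj₂ (same (t * a ⁻¹)) (subst T (sym (rescale t)) ct∈T)))
    c≡1-scaled : a' * a ⁻¹ ≡ a * a ⁻¹
    c≡1-scaled = trans (stabiliser c c-stable) (sym (⁻¹-inverseʳ a≢0))

  -- For w ≠ 0, {a | a w ∈ T} is the image of T under a bijection, so it has q/2 elements.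
  ∣T/w∣ : ∀ {w} → w ≢ 0# → count (λ a → T? (a * w)) ≡ 2 ^ k
  ∣T/w∣ {w} w≢0 = trans (count-bijection T? (_* w) (_* w ⁻¹) (λ y → ⁻¹-*-cancel y w≢0) (λ y → *-⁻¹-cancel y w≢0)) ∣T∣

  -- Three distinct nonzero u, v, u + v: each a lies in one or all three of
  -- the sets {a | a w ∈ T} (w = u, v, u + v), as T has index 2.
  indicator-triple : ∀ a u v →
    indicator (T? (a * u)) ℕ.+ indicator (T? (a * v)) ℕ.+ indicator (T? (a * (u + v)))
      ≡ 1 ℕ.+ (indicator (T? (a * u) ×-dec T? (a * v)) ℕ.+ indicator (T? (a * u) ×-dec T? (a * v)))
  indicator-triple a u v with T? (a * u) | T? (a * v) | T? (a * (u + v))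
  ... | yes _   | yes _   | yes _   = refl
  ... | yes au  | yes av  | no ¬auv = ⊥-elim (¬auv (subst T (sym (distribˡ a u v)) (T-+ au av)))
  ... | yes au  | no ¬av  | yes auv = ⊥-elim (¬av (subst T (trans (cong (a * u +_) (distribˡ a u v)) (+-cancelˡ-self (a * u) (a * v))) (T-+ au auv)))
  ... | yes _   | no _    | no _    = refl
  ... | no ¬au  | yes av  | yes auv = ⊥-elim (¬au (subst T (trans (cong (_+ a * v) (distribˡ a u v)) (+-cancelʳ-self (a * u) (a * v))) (T-+ auv av)))
  ... | no _    | yes _   | no _    = refl
  ... | no _    | no _    | yes _   = refl
  ... | no ¬au  | no ¬av  | no ¬auv = ⊥-elim (¬auv (subst T (sym (distribˡ a u v)) (outside-+ ¬au ¬av)))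

  -- Summing over a: 3 · q/2 = q + 2 · #{a | a u ∈ T, a v ∈ T}.
  ∣T/u∩T/v∣ : ∀ {u v} → u ≢ 0# → v ≢ 0# → u + v ≢ 0# →
              let C = count (λ a → T? (a * u) ×-dec T? (a * v)) in C ℕ.+ C ≡ 2 ^ k
  ∣T/u∩T/v∣ {u} {v} u≢0 v≢0 u+v≢0 = ℕₚ.+-cancelˡ-≡ q _ _ (begin
    q ℕ.+ (C ℕ.+ C)                                   ≡⟨ cong (ℕ._+ (C ℕ.+ C)) (sym (sum-1 q)) ⟩
    sum {q} (λ _ → 1) ℕ.+ (C ℕ.+ C)                   ≡⟨ cong (sum {q} (λ _ → 1) ℕ.+_) (sym (∑-distrib-+ I I)) ⟩
    sum {q} (λ _ → 1) ℕ.+ sum (λ a → I a ℕ.+ I a)     ≡⟨ sym (∑-distrib-+ (λ _ → 1) (λ a → I a ℕ.+ I a)) ⟩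
    sum (λ a → 1 ℕ.+ (I a ℕ.+ I a))                   ≡⟨ sum-cong-≗ (λ a → sym (indicator-triple a u v)) ⟩
    sum (λ a → Iu a ℕ.+ Iv a ℕ.+ Iuv a)               ≡⟨ ∑-distrib-+ (λ a → Iu a ℕ.+ Iv a) Iuv ⟩
    sum (λ a → Iu a ℕ.+ Iv a) ℕ.+ sum Iuv             ≡⟨ cong (ℕ._+ sum Iuv) (∑-distrib-+ Iu Iv) ⟩
    (sum Iu ℕ.+ sum Iv) ℕ.+ sum Iuv                   ≡⟨ cong₂ ℕ._+_ (cong₂ ℕ._+_ (∣T/w∣ u≢0) (∣T/w∣ v≢0)) (∣T/w∣ u+v≢0) ⟩
    (K ℕ.+ K) ℕ.+ K                                   ≡⟨ cong (ℕ._+ K) (sym q≡K+K) ⟩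
    q ℕ.+ K                                           ∎)
    where
    K : ℕ
    K = 2 ^ k
    Iu Iv Iuv I : Fin q → ℕ
    Iu a  = indicator (T? (a * u))
    Iv a  = indicator (T? (a * v))
    Iuv a = indicator (T? (a * (u + v)))
    I a   = indicator (T? (a * u) ×-dec T? (a * v))
    C : ℕ
    C = count (λ a → T? (a * u) ×-dec T? (a * v))

-- The blocks B(b,c) = {x^(2^h) + b x + c} over GF(2^(k+1)), gcd(h, k+1) = 1,
-- described through the hyperplane T of Hyperplane.
module BlockStructure (k h : ℕ) (F : FiniteField (2 ^ suc k)) (coprime : gcd h (suc k) ≡ 1) where
  open Hyperplane k h F coprime public
  open ≡-Reasoning

  f : Fin q → Fin q
  f x = x ^ᶠ (2 ^ h)

  OnBlock : Fin q → Fin q → Fin q → Set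
  OnBlock b c y = ∃ λ x → f x + b * x + c ≡ y

  onBlock? : ∀ b c → Decidable (OnBlock b c)
  onBlock? b c y = Finₚ.any? (λ x → f x + b * x + c Finₚ.≟ y)

  -- the slope G(w) = w^(2^h - 1) that makes b x + x^(2^h) a multiple of L
  G : Fin q → Fin q
  G w = frob h w * w ⁻¹

  G-w : ∀ {w} → w ≢ 0# → G w * w ≡ frob h w
  G-w {w} w≢0 = ⁻¹-*-cancel (frob h w) w≢0

  slope-G : ∀ {w} → w ≢ 0# → ∀ s → frob h (s * w) + G w * (s * w) ≡ frob h w * L s
  slope-G {w} w≢0 s = begin
    frob h (s * w) + G w * (s * w)   ≡⟨ cong₂ _+_ (trans (frob-* h s w) (*-comm (frob h s) (frob h w))) Gw·sw ⟩
    frob h w * frob h s + frob h w * s ≡⟨ sym (distribˡ (frob h w) (frob h s) s) ⟩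
    frob h w * L s                   ∎
    where
    Gw·sw : G w * (s * w) ≡ frob h w * s
    Gw·sw = trans (cong (G w *_) (*-comm s w)) (trans (sym (*-assoc (G w) w s)) (cong (_* s) (G-w w≢0)))

  block-G : ∀ {w} → w ≢ 0# → ∀ c y → OnBlock (G w) c y ⇔' T ((y + c) * (frob h w) ⁻¹)
  block-G {w} w≢0 c y = to , from
    where
    W : Fin q
    W = frob h w
    W≢0 : W ≢ 0#
    W≢0 = frob-≢0 h w≢0
    to : OnBlock (G w) c y → T ((y + c) * W ⁻¹)
    to (x , fx+Gwx+c≡y) = s , sym (begin
      (y + c) * W ⁻¹                               ≡⟨ cong (λ t → (t + c) * W ⁻¹) (sym fx+Gwx+c≡y) ⟩
      ((f x + G w * x + c) + c) * W ⁻¹             ≡⟨ cong (_* W ⁻¹) (+-cancelʳ-self (f x + G w * x) c) ⟩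
      (f x + G w * x) * W ⁻¹                       ≡⟨ cong (λ t → (t + G w * x) * W ⁻¹) (frob-pow h x) ⟩
      (frob h x + G w * x) * W ⁻¹                  ≡⟨ cong (λ t → (frob h t + G w * t) * W ⁻¹) (sym sw≡x) ⟩
      (frob h (s * w) + G w * (s * w)) * W ⁻¹      ≡⟨ cong (_* W ⁻¹) (trans (slope-G w≢0 s) (*-comm W (L s))) ⟩
      (L s * W) * W ⁻¹                             ≡⟨ *-⁻¹-cancel (L s) W≢0 ⟩
      L s                                          ∎)
      where
      s : Fin q
      s = x * w ⁻¹
      sw≡x : s * w ≡ x
      sw≡x = ⁻¹-*-cancel x w≢0
    from : T ((y + c) * W ⁻¹) → OnBlock (G w) c y
    from (s , Ls≡) = s * w , (begin
      f (s * w) + G w * (s * w) + c                ≡⟨ cong (λ t → t + G w * (s * w) + c) (frob-pow h (s * w)) ⟩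
      frob h (s * w) + G w * (s * w) + c           ≡⟨ cong (_+ c) (slope-G w≢0 s) ⟩
      W * L s + c                                  ≡⟨ cong (λ t → W * t + c) Ls≡ ⟩
      W * ((y + c) * W ⁻¹) + c                     ≡⟨ cong (_+ c) (trans (*-comm W _) (⁻¹-*-cancel (y + c) W≢0)) ⟩
      (y + c) + c                                  ≡⟨ +-cancelʳ-self y c ⟩
      y                                            ∎)

  G-0 : G 0# ≡ 0#
  G-0 = trans (cong (frob h 0# *_) 0⁻¹) (zeroʳ _)

  G-≢0 : ∀ {w} → w ≢ 0# → G w ≢ 0#
  G-≢0 w≢0 = *-≢0 (frob-≢0 h w≢0) (⁻¹-≢0 w≢0)

  -- G is injective: G a = G b with a, b ≠ 0 makes a/b a fixed point of frob h,
  -- so a/b = 1.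
  G-injective : ∀ {a b} → G a ≡ G b → a ≡ b
  G-injective {a} {b} Ga≡Gb with zero-or-nonzero a | zero-or-nonzero b
  ... | inj₁ a≡0 | inj₁ b≡0 = trans a≡0 (sym b≡0)
  ... | inj₁ a≡0 | inj₂ b≢0 = ⊥-elim (G-≢0 b≢0 (trans (sym Ga≡Gb) (trans (cong G a≡0) G-0)))
  ... | inj₂ a≢0 | inj₁ b≡0 = ⊥-elim (G-≢0 a≢0 (trans Ga≡Gb (trans (cong G b≡0) G-0)))
  ... | inj₂ a≢0 | inj₂ b≢0 = begin
    a                ≡⟨ sym zb≡a ⟩
    z * b            ≡⟨ cong (_* b) (frob-fixed-nonzero h coprime (*-≢0 a≢0 (⁻¹-≢0 b≢0)) z-fixed) ⟩
    1# * b           ≡⟨ *-identityˡ b ⟩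
    b                ∎
    where
    z : Fin q
    z = a * b ⁻¹
    zb≡a : z * b ≡ a
    zb≡a = ⁻¹-*-cancel a b≢0
    z-fixed : frob h z ≡ z
    z-fixed = *-cancelʳ (frob h z) z (frob-≢0 h b≢0) (begin
      frob h z * frob h b        ≡⟨ sym (frob-* h z b) ⟩
      frob h (z * b)             ≡⟨ cong (frob h) zb≡a ⟩
      frob h a                   ≡⟨ sym (G-w a≢0) ⟩
      G a * a                    ≡⟨ cong (_* a) Ga≡Gb ⟩
      G b * a                    ≡⟨ cong (G b *_) (sym zb≡a) ⟩
      G b * (z * b)              ≡⟨ trans (cong (G b *_) (*-comm z b)) (sym (*-assoc (G b) b z)) ⟩
      (G b * b) * z              ≡⟨ cong (_* z) (G-w b≢0) ⟩
      frob h b * z               ≡⟨ *-comm (frob h b) z ⟩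
      z * frob h b               ∎)

  block⇒hyperplane : ∀ {b} → b ≢ 0# → ∃ λ a → a ≢ 0# × (∀ c y → OnBlock b c y ⇔' T ((y + c) * a))
  block⇒hyperplane {b} b≢0 with injective⇒surjective G G-injective b
  ... | w , refl = (frob h w) ⁻¹ , ⁻¹-≢0 (frob-≢0 h w≢0) , block-G w≢0
    where
    w≢0 : w ≢ 0#
    w≢0 w≡0 = b≢0 (trans (cong G w≡0) G-0)

  hyperplane⇒block : ∀ {a} → a ≢ 0# → ∃ λ b → ∀ c y → OnBlock b c y ⇔' T ((y + c) * a)
  hyperplane⇒block {a} a≢0 with injective⇒surjective (frob h) (frob-injective h) (a ⁻¹)
  ... | w , Ww≡a⁻¹ = G w , λ c y → subst (λ t → OnBlock (G w) c y ⇔' T ((y + c) * t)) W⁻¹≡a (block-G w≢0 c y)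
    where
    w≢0 : w ≢ 0#
    w≢0 w≡0 = ⁻¹-≢0 a≢0 (trans (sym Ww≡a⁻¹) (trans (cong (frob h) w≡0) (frob-0 h)))
    W⁻¹≡a : (frob h w) ⁻¹ ≡ a
    W⁻¹≡a = trans (cong _⁻¹ Ww≡a⁻¹) (⁻¹-involutive a≢0)

  -- With slope 0 the block is the whole field, as f is a bijection.
  block-slope-0 : ∀ c y → OnBlock 0# c y
  block-slope-0 c y with injective⇒surjective (frob h) (frob-injective h) (y + c)
  ... | x , fx≡y+c = x , (begin
    f x + 0# * x + c        ≡⟨ cong₂ (λ s t → s + t + c) (frob-pow h x) (zeroˡ x) ⟩
    frob h x + 0# + c       ≡⟨ cong (λ t → t + 0# + c) fx≡y+c ⟩
    (y + c) + 0# + c        ≡⟨ cong (_+ c) (+-identityʳ (y + c)) ⟩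
    (y + c) + c             ≡⟨ +-cancelʳ-self y c ⟩
    y                       ∎)

  H : Fin q → Fin q → Subset q
  H a x₀ = subset (λ y → T? ((y + x₀) * a))

  ∣H∣ : ∀ {a} x₀ → a ≢ 0# → ∣ H a x₀ ∣ ≡ 2 ^ k
  ∣H∣ {a} x₀ a≢0 = begin
    ∣ H a x₀ ∣                          ≡⟨ ∣subset∣ (λ y → T? ((y + x₀) * a)) ⟩
    count (λ y → T? ((y + x₀) * a))     ≡⟨ count-bijection T? (λ y → (y + x₀) * a) (λ t → t * a ⁻¹ + x₀) there back ⟩
    count T?                            ≡⟨ ∣T∣ ⟩
    2 ^ k                             ∎
    where
    there : ∀ t → ((t * a ⁻¹ + x₀) + x₀) * a ≡ t
    there t = trans (cong (_* a) (+-cancelʳ-self (t * a ⁻¹) x₀)) (⁻¹-*-cancel t a≢0)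
    back : ∀ y → ((y + x₀) * a) * a ⁻¹ + x₀ ≡ y
    back y = trans (cong (_+ x₀) (*-⁻¹-cancel (y + x₀) a≢0)) (+-cancelʳ-self y x₀)

  H-injective : ∀ {a a'} x₀ → H a x₀ ≡ H a' x₀ → a ≡ a'
  H-injective {a} {a'} x₀ Ha≡Ha' = multiplier-injective a a' λ t →
      (λ ta∈T → shift a' (subset-injective (λ y → T? ((y + x₀) * a)) _ Ha≡Ha' (t + x₀) (unshift a ta∈T)))
    , (λ ta'∈T → shift a (subset-injective (λ y → T? ((y + x₀) * a')) _ (sym Ha≡Ha') (t + x₀) (unshift a' ta'∈T)))
    where
    shift : ∀ b {t} → T (((t + x₀) + x₀) * b) → T (t * b)
    shift b {t} = subst T (cong (_* b) (+-cancelʳ-self t x₀))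
    unshift : ∀ b {t} → T (t * b) → T (((t + x₀) + x₀) * b)
    unshift b {t} = subst T (cong (_* b) (sym (+-cancelʳ-self t x₀)))

  -- B(b,c) as a subset of GF(q); definitionally the block of Is3Design.
  Block : Fin q → Fin q → Subset q
  Block b c = subset (onBlock? b c)

  rebase : ∀ {a c x₀} → T ((x₀ + c) * a) → ∀ y → T ((y + c) * a) ⇔' T ((y + x₀) * a)
  rebase {a} {c} {x₀} x₀∈ y = (λ y∈ → subst T (sum-is y) (T-+ y∈ x₀∈))
                           , (λ y∈ → subst T (+-cancelʳ-self _ _) (subst T (cong (_+ X) (sym (sum-is y))) (T-+ y∈ x₀∈)))
    where
    X : Fin q
    X = (x₀ + c) * a
    sum-is : ∀ y → (y + c) * a + X ≡ (y + x₀) * a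
    sum-is y = trans (sym (distribʳ a (y + c) (x₀ + c)))
                     (cong (_* a) (trans (+-interchange y c x₀ c) (trans (cong ((y + x₀) +_) (x+x≡0 c)) (+-identityʳ _))))

  block⇒H : ∀ {b c x₀} → b ≢ 0# → x₀ ∈ Block b c → ∃ λ a → a ≢ 0# × Block b c ≡ H a x₀
  block⇒H {b} {c} {x₀} b≢0 x₀∈B with block⇒hyperplane b≢0
  ... | a , a≢0 , B⇔ = a , a≢0 , subset-cong (onBlock? b c) (λ y → T? ((y + x₀) * a)) λ y →
        (λ y∈B → proj₁ (rebase x₀∈H y) (proj₁ (B⇔ c y) y∈B))
      , (λ y∈H → proj₂ (B⇔ c y) (proj₂ (rebase x₀∈H y) y∈H))
    where
    x₀∈H : T ((x₀ + c) * a)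
    x₀∈H = proj₁ (B⇔ c x₀) (proj₁ (∈-subset (onBlock? b c) x₀) x₀∈B)

  H⇒block : ∀ {a} x₀ → a ≢ 0# → ∃ λ b → H a x₀ ≡ Block b x₀
  H⇒block {a} x₀ a≢0 with hyperplane⇒block a≢0
  ... | b , B⇔ = b , subset-cong (λ y → T? ((y + x₀) * a)) (onBlock? b x₀) λ y → proj₂ (B⇔ x₀ y) , proj₁ (B⇔ x₀ y)

  -- hence blocks of slope 0 are too large to have q/2 points
  ∣block-slope-0∣ : ∀ c → ∣ Block 0# c ∣ ≡ q
  ∣block-slope-0∣ c = trans (∣subset∣ (onBlock? 0# c)) (count-all (onBlock? 0# c) (block-slope-0 c))

-- The design over GF(2^(n+2)); q ≥ 4 makes q/4 an integer.
module DesignProof (n h : ℕ) (F : FiniteField (2 ^ suc (suc n))) (coprime : gcd h (suc (suc n)) ≡ 1) where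
  open BlockStructure (suc n) h F coprime
  open ≡-Reasoning

  half : q / 2 ≡ 2 ^ suc n
  half = trans (cong (_/ 2) (ℕₚ.*-comm 2 (2 ^ suc n))) (m*n/n≡m (2 ^ suc n) 2)

  quarter-1 : ∀ t → suc t ≡ 2 ^ n → (q ∸ 4) / 4 ≡ t
  quarter-1 t 1+t≡ = begin
    (q ∸ 4) / 4                        ≡⟨ cong (λ m → (2 ℕ.* (2 ℕ.* m) ∸ 4) / 4) (sym 1+t≡) ⟩
    (2 ℕ.* (2 ℕ.* suc t) ∸ 4) / 4      ≡⟨ cong (λ m → (m ∸ 4) / 4) (four-more t) ⟩
    (4 ℕ.+ t ℕ.* 4 ∸ 4) / 4            ≡⟨ cong (_/ 4) (ℕₚ.m+n∸m≡n 4 (t ℕ.* 4)) ⟩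
    (t ℕ.* 4) / 4                      ≡⟨ m*n/n≡m t 4 ⟩
    t                                  ∎
    where
    four-more : ∀ t → 2 ℕ.* (2 ℕ.* suc t) ≡ 4 ℕ.+ t ℕ.* 4
    four-more = ℕSolver.solve-∀

  module ThroughThreePoints {x₀ y₀ z₀ : Fin q} (x≢y : x₀ ≢ y₀) (x≢z : x₀ ≢ z₀) (y≢z : y₀ ≢ z₀) where
    u v : Fin q
    u = x₀ + y₀
    v = x₀ + z₀

    u≢0 : u ≢ 0#
    u≢0 u≡0 = x≢y (sum≡0⇒≡ u≡0)

    v≢0 : v ≢ 0#
    v≢0 v≡0 = x≢z (sum≡0⇒≡ v≡0)

    u+v≢0 : u + v ≢ 0#
    u+v≢0 u+v≡0 = y≢z (sum≡0⇒≡ (trans (sym u+v≡y+z) u+v≡0))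
      where
      u+v≡y+z : u + v ≡ y₀ + z₀
      u+v≡y+z = trans (+-interchange x₀ y₀ x₀ z₀) (trans (cong (_+ (y₀ + z₀)) (x+x≡0 x₀)) (+-identityˡ _))

    normal : ∀ a y → (y + x₀) * a ≡ a * (x₀ + y)
    normal a y = trans (*-comm (y + x₀) a) (cong (a *_) (+-comm y x₀))

    x₀∈H : ∀ a → x₀ ∈ H a x₀
    x₀∈H a = proj₂ (∈-subset (λ y → T? ((y + x₀) * a)) x₀)
                   (subst T (sym (trans (cong (_* a) (x+x≡0 x₀)) (zeroˡ a))) T-0)

    Normal : Fin q → Set
    Normal a = (T (a * u) × T (a * v)) × a ≢ 0#

    normal? : Decidable Normal
    normal? a = (T? (a * u) ×-dec T? (a * v)) ×-dec ¬? (a Finₚ.≟ 0#)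

    blocks : List (Subset q)
    blocks = map (λ a → H a x₀) (filter normal? (allFin q))

    blocks-unique : Unique blocks
    blocks-unique = Unique.map⁺ (H-injective x₀) (Unique.filter⁺ normal? (Unique.allFin⁺ q))

    -- #normals = #{a | a u, a v ∈ T} - 1 = q/4 - 1 (the normal 0 is excluded)
    blocks-length : suc (length blocks) ≡ 2 ^ n
    blocks-length = begin
      suc (length blocks)                   ≡⟨ cong suc (length-map (λ a → H a x₀) (filter normal? (allFin q))) ⟩
      suc (length (filter normal? (allFin q))) ≡⟨ cong suc (length-filter-tabulate normal? (λ a → a)) ⟩
      suc (count normal?)                   ≡⟨ sym (count-remove both? normal? 0# (λ _ → (λ p → p) , (λ p → p)) 0-both) ⟩
      count both?                           ≡⟨ ℕₚ.*-cancelˡ-≡ (count both?) (2 ^ n) 2 (trans doubled (∣T/u∩T/v∣ u≢0 v≢0 u+v≢0)) ⟩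
      2 ^ n                               ∎
      where
      both? : Decidable (λ a → T (a * u) × T (a * v))
      both? a = T? (a * u) ×-dec T? (a * v)
      0-both : T (0# * u) × T (0# * v)
      0-both = subst T (sym (zeroˡ u)) T-0 , subst T (sym (zeroˡ v)) T-0
      doubled : 2 ℕ.* count both? ≡ count both? ℕ.+ count both?
      doubled = cong (count both? ℕ.+_) (ℕₚ.+-identityʳ (count both?))

    on-H : ∀ {a y} → T (a * (x₀ + y)) ⇔' y ∈ H a x₀
    on-H {a} {y} = (λ a[x₀+y]∈T → proj₂ (∈-subset (λ y → T? ((y + x₀) * a)) y) (subst T (sym (normal a y)) a[x₀+y]∈T))
                 , (λ y∈H → subst T (normal a y) (proj₁ (∈-subset (λ y → T? ((y + x₀) * a)) y) y∈H))

    q≢q/2 : q ≢ q / 2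
    q≢q/2 q≡q/2 = ℕₚ.<-irrefl (sym K≡0) (ℕₚ.m^n>0 2 (suc n))
      where
      K≡0 : 2 ^ suc n ≡ 0
      K≡0 = ℕₚ.+-cancelˡ-≡ (2 ^ suc n) _ _ (trans (sym q≡K+K) (trans q≡q/2 (trans half (sym (ℕₚ.+-identityʳ _)))))

    blocks-sound : ∀ {S} → S Membership.∈ blocks → IsBlock F f (q / 2) S × x₀ ∈ S × y₀ ∈ S × z₀ ∈ S
    blocks-sound {S} S∈blocks with ∈-map⁻ (λ a → H a x₀) S∈blocks
    ... | a , a∈normals , refl with proj₂ (∈-filter⁻ normal? {xs = allFin q} a∈normals)
    ...   | (au∈T , av∈T) , a≢0 with H⇒block x₀ a≢0
    ...     | b , H≡B = (b , x₀ , H≡B , trans (∣H∣ x₀ a≢0) (sym half))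
                      , x₀∈H a , proj₁ on-H au∈T , proj₁ on-H av∈T

    blocks-complete : ∀ {S} → IsBlock F f (q / 2) S × x₀ ∈ S × y₀ ∈ S × z₀ ∈ S → S Membership.∈ blocks
    blocks-complete {S} ((b , c , refl , ∣S∣≡q/2) , x₀∈S , y₀∈S , z₀∈S) with zero-or-nonzero b
    ... | inj₁ refl = ⊥-elim (q≢q/2 (trans (sym (∣block-slope-0∣ c)) ∣S∣≡q/2))
    ... | inj₂ b≢0 with block⇒H b≢0 x₀∈S
    ...   | a , a≢0 , B≡H = subst (Membership._∈ blocks) (sym B≡H)
                              (∈-map⁺ (λ a → H a x₀) (∈-filter⁺ normal? (∈-allFin a) normal-a))
      where
      normal-a : Normal a
      normal-a = (proj₂ on-H (subst (y₀ ∈_) B≡H y₀∈S) , proj₂ on-H (subst (z₀ ∈_) B≡H z₀∈S)) , a≢0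

  design : Is3Design F f (q / 2) ((q ∸ 4) / 4)
  design x₀ y₀ z₀ x≢y x≢z y≢z =
    blocks , blocks-unique , sym (quarter-1 (length blocks) blocks-length) , λ S → blocks-sound , blocks-complete
    where open ThroughThreePoints x≢y x≢z y≢z

-- The theorem: with m = n + 2.
mainTheorem13 : (m h : ℕ) → 2 ≤ m → 1 ≤ h → gcd h m ≡ 1 →
    (F : FiniteField (2 ^ m)) →
    Is3Design F (λ x → FiniteField._^_ F x (2 ^ h)) ((2 ^ m) / 2) (((2 ^ m) ∸ 4) / 4)
mainTheorem13 (suc (suc n)) h (ℕ.s≤s (ℕ.s≤s _)) _ coprime F = DesignProof.design n h F coprime
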